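{- Let $G,G',H,H'$ be graphs with no isolated vertices such that $G$ is homotopy equivalent to $G'$ and $H$ is homotopy equivalent to $H'$. Then $G\times H$ is homotopy equivalent to $G'\times H'$.
   Context: A graph is a finite undirected graph, loops allowed, at most one edge between two vertices; a graph morphism is a vertex map preserving edges. A vertex is isolated if it has no neighbors. The product $G\times H$ has vertex set $V(G)\times V(H)$ and $(v_1,w_1)\text{ --- }(v_2,w_2)$ iff $v_1\text{ --- }v_2$ in $G$ and $w_1\text{ --- }w_2$ in $H$. The exponential graph $H^G$ has as vertices the set maps $V(G)\to V(H)$, with $f\text{ --- }g$ iff $f(v_1)\text{ --- }g(v_2)$ for every edge $v_1\text{ --- }v_2$ of $G$. Morphisms are homotopic if joined by a sequence of morphisms consecutive ones adjacent in $H^G$; graphs $G,H$ are homotopy equivalent if there are morphisms $f:G\to H$, $g:H\to G$ with $gf$, $fg$ homotopic to the identities. -}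

module Defs where

open import Level using (0ℓ)
open import Data.Nat using (ℕ)
open import Data.Fin using (Fin)
open import Data.Fin.Properties using ()
open import Data.Product using (Σ; _×_; _,_; ∃; proj₁; proj₂)
open import Data.List using (List; []; _∷_)
open import Relation.Nullary using (¬_)
open import Relation.Binary.PropositionalEquality using (_≡_)

-- A finite undirected graph (loops allowed, at most one edge between two
-- vertices): vertex set Fin size, a symmetric adjacency relation.
record Graph : Set₁ where
  field
    size : ℕ
    _—_  : Fin size → Fin size → Set
    sym  : ∀ {u v} → u — v → v — u
open Graph public

V : Graph → Set
V G = Fin (size G)

Adj : (G : Graph) → V G → V G → Set
Adj G = _—_ G

Isolated : (G : Graph) → V G → Set
Isolated G v = ∀ w → ¬ Adj G v w

NoIsolated : Graph → Set
NoIsolated G = ∀ v → ¬ Isolated G v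

IsMorphism : (G H : Graph) → (V G → V H) → Set
IsMorphism G H f = ∀ {u v} → Adj G u v → Adj H (f u) (f v)

Hom : Graph → Graph → Set
Hom G H = Σ (V G → V H) (IsMorphism G H)

-- adjacency in the exponential graph H^G between set maps
ExpAdj : (G H : Graph) → (V G → V H) → (V G → V H) → Set
ExpAdj G H f g = ∀ {v₁ v₂} → Adj G v₁ v₂ → Adj H (f v₁) (g v₂)

data Homotopic (G H : Graph) : Hom G H → Hom G H → Set where
  hrefl : ∀ f → Homotopic G H f f
  hstep : ∀ f g h → ExpAdj G H (proj₁ f) (proj₁ g) →
          Homotopic G H g h → Homotopic G H f h

idHom : (G : Graph) → Hom G G
idHom G = (λ v → v) , (λ e → e)

_∘H_ : ∀ {G H K} → Hom H K → Hom G H → Hom G K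
_∘H_ {G} {H} {K} (g , gm) (f , fm) =
  (λ v → g (f v)) , (λ {u} {v} e → gm {f u} {f v} (fm {u} {v} e))

HomotopyEquivalent : Graph → Graph → Set
HomotopyEquivalent G H =
  Σ (Hom G H) λ f → Σ (Hom H G) λ g →
    Homotopic G G (_∘H_ {G} {H} {G} g f) (idHom G) ×
    Homotopic H H (_∘H_ {H} {G} {H} f g) (idHom H)

-- categorical product G × H, vertex set Fin (|G| * |H|) via the standard
-- bijection Fin m × Fin n ≅ Fin (m * n)
open import Data.Nat using (_*_)
open import Data.Fin using (combine; remQuot)

_×G_ : Graph → Graph → Graph
G ×G H = record
  { size = size G * size H
  ; _—_  = λ x y → let a = remQuot (size H) x ; b = remQuot (size H) y in
                   Adj G (proj₁ a) (proj₁ b) × Adj H (proj₂ a) (proj₂ b)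
  ; sym  = λ { (p , q) → Graph.sym G p , Graph.sym H q }
  }

module Submission where

-- The product of graphs is a bifunctor on morphisms which respects homotopy,
-- so it carries pairs of homotopy equivalences to homotopy equivalences.
--
-- The corollary follows: if g ∘ f ≃ id and k ∘ h ≃ id, then
-- (g ⊗ k) ∘ (f ⊗ h) = (g ∘ f) ⊗ (k ∘ h) ≃ id ⊗ id = id, and symmetrically.

open import Defs
open import Data.Product using (_×_; _,_; proj₁; proj₂)
open import Data.Fin using (combine; remQuot)
open import Data.Fin.Properties using (remQuot-combine; combine-remQuot)
open import Relation.Binary.PropositionalEquality
  using (_≡_; subst; subst₂; cong) renaming (sym to ≡-sym)

combine-adj : ∀ (G H : Graph) {a₁ a₂ : V G} {b₁ b₂ : V H} →
  Adj G a₁ a₂ → Adj H b₁ b₂ →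
  Adj (G ×G H) (combine a₁ b₁) (combine a₂ b₂)
combine-adj G H {a₁} {a₂} {b₁} {b₂} p q =
  subst₂ (λ x y → Adj G (proj₁ x) (proj₁ y) × Adj H (proj₂ x) (proj₂ y))
    (≡-sym (remQuot-combine {size G} {size H} a₁ b₁))
    (≡-sym (remQuot-combine {size G} {size H} a₂ b₂))
    (p , q)

homotopic-trans : ∀ {A B : Graph} {f g h : Hom A B} →
  Homotopic A B f g → Homotopic A B g h → Homotopic A B f h
homotopic-trans (hrefl _) r = r
homotopic-trans (hstep f g _ e r) s = hstep f g _ e (homotopic-trans r s)

-- Pointwise equal morphisms are homotopic: f is adjacent to g in B^A
-- because g is a morphism.
pointwise⇒homotopic : ∀ (A B : Graph) (f g : Hom A B) →
  (∀ x → proj₁ f x ≡ proj₁ g x) → Homotopic A B f g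
pointwise⇒homotopic A B f g f≗g =
  hstep f g g
    (λ {v₁} {v₂} e → subst (λ z → Adj B z (proj₁ g v₂)) (≡-sym (f≗g v₁)) (proj₂ g e))
    (hrefl g)

module Product (G G′ H H′ : Graph) where

  ⟨_⊗_⟩ : (V G → V G′) → (V H → V H′) → V (G ×G H) → V (G′ ×G H′)
  ⟨ f ⊗ h ⟩ x = let (a , b) = remQuot (size H) x in combine (f a) (h b)

  ⊗-expAdj : ∀ {f g h k} → ExpAdj G G′ f g → ExpAdj H H′ h k →
    ExpAdj (G ×G H) (G′ ×G H′) ⟨ f ⊗ h ⟩ ⟨ g ⊗ k ⟩
  ⊗-expAdj f—g h—k (p , q) = combine-adj G′ H′ (f—g p) (h—k q)

  -- The product of two morphisms (a morphism is a self-adjacent map).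
  _⊗_ : Hom G G′ → Hom H H′ → Hom (G ×G H) (G′ ×G H′)
  (f , f-mor) ⊗ (h , h-mor) = ⟨ f ⊗ h ⟩ , ⊗-expAdj f-mor h-mor

  ⊗-congˡ : ∀ {f g} (h : Hom H H′) → Homotopic G G′ f g →
    Homotopic (G ×G H) (G′ ×G H′) (f ⊗ h) (g ⊗ h)
  ⊗-congˡ h (hrefl f) = hrefl (f ⊗ h)
  ⊗-congˡ h (hstep f g _ f—g r) =
    hstep (f ⊗ h) (g ⊗ h) _ (⊗-expAdj f—g (proj₂ h)) (⊗-congˡ h r)

  ⊗-congʳ : ∀ {h k} (f : Hom G G′) → Homotopic H H′ h k →
    Homotopic (G ×G H) (G′ ×G H′) (f ⊗ h) (f ⊗ k)
  ⊗-congʳ f (hrefl h) = hrefl (f ⊗ h)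
  ⊗-congʳ f (hstep h k _ h—k r) =
    hstep (f ⊗ h) (f ⊗ k) _ (⊗-expAdj (proj₂ f) h—k) (⊗-congʳ f r)

  ⊗-cong : ∀ {f g h k} → Homotopic G G′ f g → Homotopic H H′ h k →
    Homotopic (G ×G H) (G′ ×G H′) (f ⊗ h) (g ⊗ k)
  ⊗-cong {g = g} {h = h} f≃g h≃k =
    homotopic-trans (⊗-congˡ h f≃g) (⊗-congʳ g h≃k)

open Product using (⟨_⊗_⟩; _⊗_; ⊗-cong)

⊗-∘ : ∀ (G G′ G″ H H′ H″ : Graph)
  (f : V G → V G′) (g : V G′ → V G″) (h : V H → V H′) (k : V H′ → V H″) →
  ∀ x → ⟨_⊗_⟩ G′ G″ H′ H″ g k (⟨_⊗_⟩ G G′ H H′ f h x)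
      ≡ ⟨_⊗_⟩ G G″ H H″ (λ v → g (f v)) (λ v → k (h v)) x
⊗-∘ G G′ G″ H H′ H″ f g h k x =
  let (a , b) = remQuot (size H) x in
  cong (λ p → combine (g (proj₁ p)) (k (proj₂ p)))
       (remQuot-combine {size G′} {size H′} (f a) (h b))

⊗-id : ∀ (G H : Graph) →
  ∀ x → ⟨_⊗_⟩ G G H H (λ v → v) (λ v → v) x ≡ x
⊗-id G H = combine-remQuot {size G} (size H)

⊗-leftInverse : ∀ (G G′ H H′ : Graph)
  (f : Hom G G′) (g : Hom G′ G) (h : Hom H H′) (k : Hom H′ H) →
  Homotopic G G (_∘H_ {G} {G′} {G} g f) (idHom G) →
  Homotopic H H (_∘H_ {H} {H′} {H} k h) (idHom H) →
  Homotopic (G ×G H) (G ×G H)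
    (_∘H_ {G ×G H} {G′ ×G H′} {G ×G H}
       (_⊗_ G′ G H′ H g k) (_⊗_ G G′ H H′ f h))
    (idHom (G ×G H))
⊗-leftInverse G G′ H H′ f g h k gf≃id kh≃id =
  homotopic-trans
    (pointwise⇒homotopic (G ×G H) (G ×G H) _ gf⊗kh
       (⊗-∘ G G′ G H H′ H (proj₁ f) (proj₁ g) (proj₁ h) (proj₁ k)))
    (homotopic-trans (⊗-cong G G H H gf≃id kh≃id)
       (pointwise⇒homotopic (G ×G H) (G ×G H) _ (idHom (G ×G H)) (⊗-id G H)))
  where
  gf⊗kh : Hom (G ×G H) (G ×G H)
  gf⊗kh = _⊗_ G G H H (_∘H_ {G} {G′} {G} g f) (_∘H_ {H} {H′} {H} k h)

corollary5p8 : (G G′ H H′ : Graph) →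
    NoIsolated G → NoIsolated G′ → NoIsolated H → NoIsolated H′ →
    HomotopyEquivalent G G′ → HomotopyEquivalent H H′ →
    HomotopyEquivalent (G ×G H) (G′ ×G H′)
corollary5p8 G G′ H H′ _ _ _ _ (f , g , gf≃id , fg≃id) (h , k , kh≃id , hk≃id) =
  _⊗_ G G′ H H′ f h ,
  _⊗_ G′ G H′ H g k ,
  ⊗-leftInverse G G′ H H′ f g h k gf≃id kh≃id ,
  ⊗-leftInverse G′ G H′ H g f k h fg≃id hk≃id
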